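{- Let $G$ be a partial cube. If two distinct convex cycles $D_1,D_2$ of $G$ share more than a single edge or a single vertex (i.e. their intersection is neither empty, nor a single vertex, nor a single edge with its endpoints), then $D_1$ and $D_2$ intertwine.
   Context: A subgraph $H$ of $G$ is isometric if $d_H(x,y)=d_G(x,y)$ for all $x,y\in V(H)$, and convex if for all $x,y\in V(H)$ every shortest $x,y$-path of $G$ lies in $H$. A partial cube is a graph isomorphic to an isometric subgraph of a hypercube. Two isometric cycles $D_1=(v_0v_1\ldots v_mv_{m+1}\ldots v_{2m+2n_1-1})$ and $D_2=(u_0u_1\ldots u_mu_{m+1}\ldots u_{2m+2n_2-1})$ intertwine if $u_0=v_0,\ldots,u_m=v_m$ for some $m\geq 2$ and all other vertices of the two cycles are pairwise different (so they share exactly a path with $m\ge 2$ edges); $i(D_1,D_2)=n_1+n_2$ is the residue of intertwining. -}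

module Defs where

open import Data.Nat using (ℕ; zero; suc; _+_; _*_; _≤_)
open import Data.Fin using (Fin; zero; suc; toℕ; inject₁; fromℕ)
open import Data.Vec using (Vec; updateAt)
open import Data.Bool using (Bool; not)
open import Data.Product using (Σ; ∃; ∃-syntax; _×_; _,_)
open import Data.Sum using (_⊎_)
open import Relation.Nullary using (¬_)
open import Relation.Binary.PropositionalEquality using (_≡_)
open import Function.Definitions using (Injective)
open import Function.Bundles using (_⇔_)

SimpleGraph : ∀ {n} → (Fin n → Fin n → Set) → Set
SimpleGraph {n} Adj = (∀ x y → Adj x y → Adj y x) × (∀ x → ¬ Adj x x)

module _ {V : Set} (R : V → V → Set) where

  data Walk : V → V → Set where
    []  : ∀ {x} → Walk x x
    _∷_ : ∀ {x y z} → R x y → Walk y z → Walk x z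

  len : ∀ {x y} → Walk x y → ℕ
  len []       = 0
  len (_ ∷ w)  = suc (len w)

  Dist : V → V → ℕ → Set
  Dist x y k = (Σ (Walk x y) λ w → len w ≡ k) × (∀ (w : Walk x y) → k ≤ len w)

  Shortest : ∀ {x y} → Walk x y → Set
  Shortest {x} {y} w = ∀ (w' : Walk x y) → len w ≤ len w'

QAdj : (m : ℕ) → Vec Bool m → Vec Bool m → Set
QAdj m u v = ∃[ i ] v ≡ updateAt u i not

-- G is isomorphic to an isometric subgraph H of a hypercube Q_m:
-- f is an injective map V(G) → V(Q_m) preserving edges (so its image with the
-- image edges is a subgraph H ≅ G), and d_H = d_{Q_m} on H, i.e.
-- d_G(x,y) = d_{Q_m}(f x, f y).
PartialCube : ∀ {n} → (Fin n → Fin n → Set) → Set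
PartialCube {n} Adj =
  ∃[ m ] Σ (Fin n → Vec Bool m) λ f →
    Injective _≡_ _≡_ f ×
    (∀ x y → Adj x y → QAdj m (f x) (f y)) ×
    (∀ x y k → Dist Adj x y k ⇔ Dist (QAdj m) (f x) (f y) k)

record Subgraph (V : Set) : Set₁ where
  field
    VP : V → Set
    EP : V → V → Set
open Subgraph public

module _ {V : Set} (R : V → V → Set) where

  WalkIn : (H : Subgraph V) → ∀ {x y} → Walk R x y → Set
  WalkIn H {x} [] = VP H x
  WalkIn H {x} (_∷_ {y = y} _ w) = VP H x × EP H x y × WalkIn H w

  Convex : Subgraph V → Set
  Convex H = ∀ x y → VP H x → VP H y →
             (w : Walk R x y) → Shortest R w → WalkIn H w

  Isometric : Subgraph V → Set
  Isometric H = ∀ x y k → VP H x → VP H y →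
                Dist (EP H) x y k ⇔ Dist R x y k

SameSub : ∀ {V} → Subgraph V → Subgraph V → Set
SameSub H₁ H₂ = (∀ v → VP H₁ v ⇔ VP H₂ v) × (∀ a b → EP H₁ a b ⇔ EP H₂ a b)

-- Cycles: a cycle of length 3+k is an injective sequence
-- vert 0, vert 1, …, vert (2+k) of vertices, consecutive ones adjacent,
-- and vert (2+k) adjacent to vert 0.

record Cycle {V : Set} (Adj : V → V → Set) : Set where
  field
    k       : ℕ
    vert    : Fin (3 + k) → V
    injv    : Injective _≡_ _≡_ vert
    step    : ∀ (i : Fin (2 + k)) → Adj (vert (inject₁ i)) (vert (suc i))
    closing : Adj (vert (fromℕ (2 + k))) (vert zero)
open Cycle public

module _ {V : Set} {Adj : V → V → Set} where

  cycLength : Cycle Adj → ℕ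
  cycLength D = 3 + k D

  CycV : Cycle Adj → V → Set
  CycV D v = ∃[ i ] vert D i ≡ v

  UPair : V → V → V → V → Set
  UPair a b p q = (a ≡ p × b ≡ q) ⊎ (a ≡ q × b ≡ p)

  CycE : Cycle Adj → V → V → Set
  CycE D a b =
    (∃[ i ] UPair a b (vert D (inject₁ i)) (vert D (suc i)))
    ⊎ UPair a b (vert D (fromℕ (2 + k D))) (vert D zero)

  asSub : Cycle Adj → Subgraph V
  asSub D = record { VP = CycV D ; EP = CycE D }

  Common : Cycle Adj → Cycle Adj → V → Set
  Common D₁ D₂ v = CycV D₁ v × CycV D₂ v

  CommonE : Cycle Adj → Cycle Adj → V → V → Set
  CommonE D₁ D₂ a b = CycE D₁ a b × CycE D₂ a b

  IntEmpty : Cycle Adj → Cycle Adj → Set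
  IntEmpty D₁ D₂ = ∀ v → ¬ Common D₁ D₂ v

  IntVertex : Cycle Adj → Cycle Adj → Set
  IntVertex D₁ D₂ = ∃[ a ] (∀ v → Common D₁ D₂ v ⇔ v ≡ a)

  IntEdge : Cycle Adj → Cycle Adj → Set
  IntEdge D₁ D₂ = ∃[ a ] ∃[ b ]
    ((∀ v → Common D₁ D₂ v ⇔ (v ≡ a ⊎ v ≡ b)) × CommonE D₁ D₂ a b)

  -- D₁, D₂ intertwine: there are enumerations
  --   D₁ = (v_0 … v_m v_{m+1} … v_{2m+2n₁-1}),
  --   D₂ = (u_0 … u_m u_{m+1} … u_{2m+2n₂-1})
  -- of the (isometric) cycles with m ≥ 2, u_i = v_i for i ≤ m, and all
  -- other vertices pairwise different.
  Intertwine : Cycle Adj → Cycle Adj → Set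
  Intertwine D₁ D₂ =
    Isometric Adj (asSub D₁) × Isometric Adj (asSub D₂) ×
    ∃[ m ] ∃[ n₁ ] ∃[ n₂ ] Σ (Cycle Adj) λ E₁ → Σ (Cycle Adj) λ E₂ →
      2 ≤ m ×
      SameSub (asSub E₁) (asSub D₁) × SameSub (asSub E₂) (asSub D₂) ×
      cycLength E₁ ≡ 2 * m + 2 * n₁ × cycLength E₂ ≡ 2 * m + 2 * n₂ ×
      (∀ (i : Fin (3 + k E₁)) (j : Fin (3 + k E₂)) →
         toℕ i ≡ toℕ j → toℕ i ≤ m → vert E₁ i ≡ vert E₂ j) ×
      (∀ (i : Fin (3 + k E₁)) (j : Fin (3 + k E₂)) →
         vert E₁ i ≡ vert E₂ j → (toℕ i ≤ m × toℕ j ≤ m))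

module Submission where

-- A partial cube carries a bipartite metric: the Hamming distance of its
-- embedding is the graph distance, and the parity of the embedding is a
-- proper 2-colouring (Hypercube); the rest of the proof only uses this.
-- Cycles are handled as periodic sequences u : ℕ → V, which can be rotated
-- and reflected without changing the subgraph (PeriodicCycles).  A convex
-- cycle has even length 2L and its arcs of length ≤ L are geodesics
-- (ConvexCycles).  So if D₁ has a vertex outside D₂, we rotate D₁ until
-- u 0 ∈ D₂ and u (−1) ∉ D₂; the convex subgraph D₂ then meets D₁ exactly in
-- an arc u 0 … u m with m < L, and 2 ≤ m since the intersection is neither a
-- vertex nor an edge (Intersection.Arc).  Re-indexing D₂ to start with u 0,
-- u 1, it follows D₁ along the arc, the arc is at most half of D₂ too, and
-- the cycles meet nowhere else (Arc.Alignment): that is the intertwining.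
-- If each cycle's vertices lie in the other, the two convex (hence induced)
-- cycles coincide, which is excluded (Intertwining.theorem).

open import Defs
open import Data.Nat using (ℕ; zero; suc; _+_; _*_; _∸_; _≤_; _<_; z≤n; s≤s)
open import Data.Nat.Properties
open import Data.Nat.DivMod using (_%_; m%n<n; m<n⇒m%n≡m; n%n≡0)
open import Data.Fin using (Fin; zero; suc; toℕ; fromℕ<; fromℕ; inject₁)
open import Data.Fin.Properties using (toℕ-injective; toℕ<n; toℕ-fromℕ; toℕ-fromℕ<; toℕ-inject₁)
open import Data.Bool using (Bool; not)
open import Data.Bool.Properties using (not-¬; not-involutive)
open import Data.Product using (Σ; ∃; _×_; _,_; proj₁; proj₂; swap)
open import Data.Sum using (_⊎_; inj₁; inj₂)
open import Data.Empty using (⊥-elim)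
open import Relation.Nullary using (¬_; Dec; yes; no; contradiction)
open import Relation.Binary.Definitions using (tri<; tri≈; tri>)
open import Relation.Binary.PropositionalEquality
  using (_≡_; _≢_; refl; sym; trans; cong; cong₂; subst; subst₂; module ≡-Reasoning)
open import Function.Bundles using (_⇔_; mk⇔; Equivalence)

-- A cycle of length N is indexed by all
-- of ℕ, periodically; this module provides the arithmetic of such indices.
-- In particular c behaves as −1: rotating by a is undone by rotating by
-- c * a, and i ↦ c * i reverses the orientation of the cycle.
module Modular (c : ℕ) where
  open import Data.Nat.DivMod using (%-distribˡ-+; %-distribˡ-*; m*n%n≡0; [m+n]%n≡m%n; m%n%n≡m%n)

  N : ℕ
  N = suc c

  -- a record rather than a bare equation, so that it is not unfolded during unification
  infix 4 _≈_
  record _≈_ (x y : ℕ) : Set where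
    constructor mk
    field un : x % N ≡ y % N
  open _≈_ public

  ≈-refl : ∀ {x} → x ≈ x
  ≈-refl = mk refl

  ≈-sym : ∀ {x y} → x ≈ y → y ≈ x
  ≈-sym (mk e) = mk (sym e)

  ≈-trans : ∀ {x y z} → x ≈ y → y ≈ z → x ≈ z
  ≈-trans (mk e) (mk f) = mk (trans e f)

  ≡⇒≈ : ∀ {x y} → x ≡ y → x ≈ y
  ≡⇒≈ refl = ≈-refl

  +-congʳ : ∀ {x y} z → x ≈ y → x + z ≈ y + z
  +-congʳ {x} {y} z (mk e) = mk (begin
    (x + z) % N           ≡⟨ %-distribˡ-+ x z N ⟩
    (x % N + z % N) % N   ≡⟨ cong (λ a → (a + z % N) % N) e ⟩
    (y % N + z % N) % N   ≡⟨ %-distribˡ-+ y z N ⟨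
    (y + z) % N           ∎)
    where open ≡-Reasoning

  +-congˡ : ∀ {x y} z → x ≈ y → z + x ≈ z + y
  +-congˡ {x} {y} z e rewrite +-comm z x | +-comm z y = +-congʳ z e

  suc-cong : ∀ {x y} → x ≈ y → suc x ≈ suc y
  suc-cong = +-congˡ 1

  *-congˡ : ∀ {x y} z → x ≈ y → z * x ≈ z * y
  *-congˡ {x} {y} z (mk e) = mk (begin
    (z * x) % N               ≡⟨ %-distribˡ-* z x N ⟩
    (z % N * (x % N)) % N     ≡⟨ cong (λ a → (z % N * a) % N) e ⟩
    (z % N * (y % N)) % N     ≡⟨ %-distribˡ-* z y N ⟨
    (z * y) % N               ∎)
    where open ≡-Reasoning

  +N : ∀ x → x + N ≈ x
  +N x = mk ([m+n]%n≡m%n x N)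

  %≈ : ∀ x → x % N ≈ x
  %≈ x = mk (m%n%n≡m%n x N)

  %<N : ∀ x → x % N < N
  %<N x = m%n<n x N

  +-inverse : ∀ x → x + c * x ≈ 0
  +-inverse x rewrite *-comm N x = mk (m*n%n≡0 x N)

  cancelʳ : ∀ {x y} z → x + z ≈ y + z → x ≈ y
  cancelʳ {x} {y} z e = ≈-trans (≈-sym (drop x)) (≈-trans (≡⇒≈ (sym (+-assoc x z (c * z))))
                          (≈-trans (+-congʳ (c * z) e) (≈-trans (≡⇒≈ (+-assoc y z (c * z))) (drop y))))
    where
    drop : ∀ w → w + (z + c * z) ≈ w
    drop w = ≈-trans (+-congˡ w (+-inverse z)) (≡⇒≈ (+-identityʳ w))

  cancelˡ : ∀ {x y} z → z + x ≈ z + y → x ≈ y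
  cancelˡ {x} {y} z e rewrite +-comm z x | +-comm z y = cancelʳ z e

  ≈⇒≡ : ∀ {x y} → x < N → y < N → x ≈ y → x ≡ y
  ≈⇒≡ {x} {y} p q (mk e) = trans (sym (m<n⇒m%n≡m p)) (trans e (m<n⇒m%n≡m q))

  rotate-back : ∀ a j → (j + c * a) + a ≈ j
  rotate-back a j = ≈-trans (≡⇒≈ (trans (+-assoc j (c * a) a) (cong (j +_) (+-comm (c * a) a))))
                      (≈-trans (+-congˡ j (+-inverse a)) (≡⇒≈ (+-identityʳ j)))

  neg-neg : ∀ j → c * (c * j) ≈ j
  neg-neg j = cancelʳ (c * j) (≈-trans (≡⇒≈ (+-comm (c * (c * j)) (c * j)))
                (≈-trans (+-inverse (c * j)) (≈-sym (+-inverse j))))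

  neg-injective : ∀ {x y} → c * x ≈ c * y → x ≈ y
  neg-injective {x} {y} e = ≈-trans (≈-sym (neg-neg x)) (≈-trans (*-congˡ c e) (neg-neg y))

  neg-step : ∀ i → c * i ≈ suc (c * suc i)
  neg-step i = ≈-trans (≈-sym (+N (c * i)))
                 (≡⇒≈ (trans (+-comm (c * i) N) (cong suc (sym (*-suc c i)))))

  neg-suc-neg : ∀ {p q} → suc q ≈ p → c * suc (c * p) ≈ q
  neg-suc-neg {p} {q} q+1≈p =
    ≈-trans (≡⇒≈ (*-suc c (c * p))) (≈-trans (+-congˡ c (neg-neg p)) (≈-trans (+-congˡ c (≈-sym q+1≈p))
      (≈-trans (≡⇒≈ (trans (+-suc c q) (+-comm N q))) (+N q))))

  edge-index : ∀ i → (∃ λ (j : Fin c) → toℕ j ≡ i % N × suc (toℕ j) ≡ suc i % N)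
                     ⊎ (i % N ≡ c × suc i % N ≡ 0)
  edge-index i with <-cmp (i % N) c
  ... | tri< r<c _ _ = inj₁ (fromℕ< r<c , toℕ-fromℕ< r<c ,
          trans (cong suc (toℕ-fromℕ< r<c)) (sym (trans (un (suc-cong (≈-sym (%≈ i)))) (m<n⇒m%n≡m (s≤s r<c)))))
  ... | tri≈ _ r≡c _ = inj₂ (r≡c , trans (un (suc-cong (≈-sym (%≈ i)))) (trans (cong (λ z → suc z % N) r≡c) (n%n≡0 N)))
  ... | tri> _ _ c<r = ⊥-elim (<⇒≱ (%<N i) c<r)

record BipartiteMetric {V : Set} (Adj : V → V → Set) : Set where
  field
    d           : V → V → ℕ
    d-dist      : ∀ x y → Dist Adj x y (d x y)
    d-sym       : ∀ x y → d x y ≡ d y x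
    colour      : V → Bool
    colour-flip : ∀ {x y} → Adj x y → colour y ≡ not (colour x)

-- In the hypercube Q_m the distance is the Hamming distance and the parity
-- of the number of ones is a proper 2-colouring; a partial cube inherits both
-- through its isometric embedding.
module Hypercube where
  open import Data.Vec using (Vec; []; _∷_; updateAt)
  open import Data.Bool using (true; false; _xor_)

  dif : Bool → Bool → ℕ
  dif true  true  = 0
  dif false false = 0
  dif true  false = 1
  dif false true  = 1

  ham : ∀ {m} → Vec Bool m → Vec Bool m → ℕ
  ham []      []      = 0
  ham (a ∷ u) (b ∷ v) = dif a b + ham u v

  ham-refl : ∀ {m} (u : Vec Bool m) → ham u u ≡ 0
  ham-refl []          = refl
  ham-refl (true ∷ u)  = ham-refl u
  ham-refl (false ∷ u) = ham-refl u

  dif-sym : ∀ a b → dif a b ≡ dif b a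
  dif-sym true  true  = refl
  dif-sym true  false = refl
  dif-sym false true  = refl
  dif-sym false false = refl

  ham-sym : ∀ {m} (u v : Vec Bool m) → ham u v ≡ ham v u
  ham-sym []      []      = refl
  ham-sym (a ∷ u) (b ∷ v) = cong₂ _+_ (dif-sym a b) (ham-sym u v)

  dif-not : ∀ a b → dif a b ≤ suc (dif (not a) b)
  dif-not true  true  = z≤n
  dif-not true  false = s≤s z≤n
  dif-not false true  = s≤s z≤n
  dif-not false false = z≤n

  ham-flip : ∀ {m} (u : Vec Bool m) i w → ham u w ≤ suc (ham (updateAt u i not) w)
  ham-flip (a ∷ u) zero    (b ∷ w) = +-monoˡ-≤ (ham u w) (dif-not a b)
  ham-flip (a ∷ u) (suc i) (b ∷ w) = begin
    dif a b + ham u w                           ≤⟨ +-monoʳ-≤ (dif a b) (ham-flip u i w) ⟩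
    dif a b + suc (ham (updateAt u i not) w)    ≡⟨ +-suc (dif a b) _ ⟩
    suc (dif a b + ham (updateAt u i not) w)    ∎
    where open ≤-Reasoning

  ham-lower : ∀ {m} {u v : Vec Bool m} (w : Walk (QAdj m) u v) → ham u v ≤ len _ w
  ham-lower {u = u}     []                 = ≤-reflexive (ham-refl u)
  ham-lower {u = u} {v} ((i , refl) ∷ w) = ≤-trans (ham-flip u i v) (s≤s (ham-lower w))

  extend : ∀ {m} a {u v : Vec Bool m} (w : Walk (QAdj m) u v) →
           Σ (Walk (QAdj (suc m)) (a ∷ u) (a ∷ v)) λ w' → len _ w' ≡ len _ w
  extend a []               = [] , refl
  extend a ((i , refl) ∷ w) = let (w' , l) = extend a w in ((suc i , refl) ∷ w') , cong suc l

  fix-head : ∀ {m} a b {u v : Vec Bool m} (w : Walk (QAdj (suc m)) (b ∷ u) (b ∷ v)) →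
             Σ (Walk (QAdj (suc m)) (a ∷ u) (b ∷ v)) λ w' → len _ w' ≡ dif a b + len _ w
  fix-head true  true  w = w , refl
  fix-head false false w = w , refl
  fix-head true  false w = ((zero , refl) ∷ w) , refl
  fix-head false true  w = ((zero , refl) ∷ w) , refl

  ham-walk : ∀ {m} (u v : Vec Bool m) → Σ (Walk (QAdj m) u v) λ w → len _ w ≡ ham u v
  ham-walk []      []      = [] , refl
  ham-walk (a ∷ u) (b ∷ v) =
    let (w  , l)  = ham-walk u v
        (w' , l') = extend b w
        (w″ , l″) = fix-head a b w'
    in w″ , trans l″ (cong (dif a b +_) (trans l' l))

  ham-dist : ∀ {m} (u v : Vec Bool m) → Dist (QAdj m) u v (ham u v)
  ham-dist u v = ham-walk u v , ham-lower

  parity : ∀ {m} → Vec Bool m → Bool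
  parity []      = false
  parity (a ∷ u) = a xor parity u

  xor-not : ∀ a b → a xor not b ≡ not (a xor b)
  xor-not true  b = refl
  xor-not false b = refl

  parity-flip : ∀ {m} (u : Vec Bool m) i → parity (updateAt u i not) ≡ not (parity u)
  parity-flip (true ∷ u)  zero    = sym (not-involutive (parity u))
  parity-flip (false ∷ u) zero    = refl
  parity-flip (a ∷ u)     (suc i) = trans (cong (a xor_) (parity-flip u i)) (xor-not a (parity u))

  partialCube-metric : ∀ {n} (Adj : Fin n → Fin n → Set) → PartialCube Adj → BipartiteMetric Adj
  partialCube-metric Adj (m , f , _ , f-adj , f-dist) = record
    { d           = λ x y → ham (f x) (f y)
    ; d-dist      = λ x y → Equivalence.from (f-dist x y _) (ham-dist (f x) (f y))
    ; d-sym       = λ x y → ham-sym (f x) (f y)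
    ; colour      = λ x → parity (f x)
    ; colour-flip = λ {x} {y} e → let (i , fy) = f-adj x y e in
                      trans (cong parity fy) (parity-flip (f x) i)
    }

module Subgraphs {V : Set} (Adj : V → V → Set) where
  open import Function.Properties.Equivalence using () renaming (refl to ⇔-refl; sym to ⇔-sym; trans to ⇔-trans)
  open import Data.Product.Function.NonDependent.Propositional using (_×-⇔_)

  walk-start : ∀ (H : Subgraph V) {x y} (w : Walk Adj x y) → WalkIn Adj H w → VP H x
  walk-start H []      p       = p
  walk-start H (_ ∷ _) (p , _) = p

  WalkIn-mono : ∀ (H H' : Subgraph V) → (∀ v → VP H v → VP H' v) → (∀ a b → EP H a b → EP H' a b) →
                ∀ {x y} (w : Walk Adj x y) → WalkIn Adj H w → WalkIn Adj H' w
  WalkIn-mono H H' fv fe []      p           = fv _ p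
  WalkIn-mono H H' fv fe (_ ∷ w) (p , q , r) = fv _ p , fe _ _ q , WalkIn-mono H H' fv fe w r

  SameSub-sym : ∀ {H H' : Subgraph V} → SameSub H H' → SameSub H' H
  SameSub-sym (sv , se) = (λ v → ⇔-sym (sv v)) , (λ a b → ⇔-sym (se a b))

  SameSub-trans : ∀ {H H' H″ : Subgraph V} → SameSub H H' → SameSub H' H″ → SameSub H H″
  SameSub-trans (sv , se) (tv , te) = (λ v → ⇔-trans (sv v) (tv v)) , (λ a b → ⇔-trans (se a b) (te a b))

  MeetInVertex : Subgraph V → Subgraph V → Set
  MeetInVertex H₁ H₂ = ∃ λ a → ∀ v → (VP H₁ v × VP H₂ v) ⇔ v ≡ a

  MeetInEdge : Subgraph V → Subgraph V → Set
  MeetInEdge H₁ H₂ = ∃ λ a → ∃ λ b → (∀ v → (VP H₁ v × VP H₂ v) ⇔ (v ≡ a ⊎ v ≡ b)) × EP H₁ a b × EP H₂ a b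

  common-transfer : ∀ {H₁ H₁' H₂ : Subgraph V} → SameSub H₁ H₁' → ∀ v → (VP H₁ v × VP H₂ v) ⇔ (VP H₁' v × VP H₂ v)
  common-transfer (sv , _) v = sv v ×-⇔ ⇔-refl

  common-swap : ∀ {H₁ H₂ : Subgraph V} v → (VP H₂ v × VP H₁ v) ⇔ (VP H₁ v × VP H₂ v)
  common-swap v = mk⇔ swap swap

  vertex-transfer : ∀ {H₁ H₁' H₂ : Subgraph V} → SameSub H₁ H₁' → MeetInVertex H₁' H₂ → MeetInVertex H₁ H₂
  vertex-transfer {H₂ = H₂} S (a , h) = a , λ v → ⇔-trans (common-transfer {H₂ = H₂} S v) (h v)

  edge-transfer : ∀ {H₁ H₁' H₂ : Subgraph V} → SameSub H₁ H₁' → MeetInEdge H₁' H₂ → MeetInEdge H₁ H₂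
  edge-transfer {H₂ = H₂} S (a , b , h , e₁ , e₂) =
    a , b , (λ v → ⇔-trans (common-transfer {H₂ = H₂} S v) (h v)) , Equivalence.from (proj₂ S a b) e₁ , e₂

  vertex-swap : ∀ {H₁ H₂ : Subgraph V} → MeetInVertex H₁ H₂ → MeetInVertex H₂ H₁
  vertex-swap {H₁} {H₂} (a , h) = a , λ v → ⇔-trans (common-swap {H₁} {H₂} v) (h v)

  edge-swap : ∀ {H₁ H₂ : Subgraph V} → MeetInEdge H₁ H₂ → MeetInEdge H₂ H₁
  edge-swap {H₁} {H₂} (a , b , h , e₁ , e₂) = a , b , (λ v → ⇔-trans (common-swap {H₁} {H₂} v) (h v)) , e₂ , e₁

  Convex-transfer : ∀ {H H' : Subgraph V} → SameSub H H' → Convex Adj H → Convex Adj H'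
  Convex-transfer {H} {H'} (sv , se) cv x y px py w sh =
    WalkIn-mono H H' (λ v → Equivalence.to (sv v)) (λ a b → Equivalence.to (se a b)) w
      (cv x y (Equivalence.from (sv x) px) (Equivalence.from (sv y) py) w sh)

  -- In a loopless graph a convex subgraph is induced: an edge of G between
  -- two of its vertices is a shortest path, hence an edge of the subgraph.
  convex-induced : (∀ x → ¬ Adj x x) → ∀ (H : Subgraph V) → Convex Adj H →
                   ∀ {a b} → VP H a → VP H b → Adj a b → EP H a b
  convex-induced irr H cv {a} {b} pa pb e = proj₁ (proj₂ (cv a b pa pb (e ∷ []) edge-shortest))
    where
    edge-shortest : Shortest Adj (e ∷ [])
    edge-shortest []      = ⊥-elim (irr _ e)
    edge-shortest (_ ∷ _) = s≤s z≤n

  module Geodesics (d : V → V → ℕ) (d-dist : ∀ x y → Dist Adj x y (d x y)) where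

    d-lower : ∀ {x y} (w : Walk Adj x y) → d x y ≤ len Adj w
    d-lower {x} {y} = proj₂ (d-dist x y)

    geodesic : ∀ x y → Walk Adj x y
    geodesic x y = proj₁ (proj₁ (d-dist x y))

    geodesic-len : ∀ x y → len Adj (geodesic x y) ≡ d x y
    geodesic-len x y = proj₂ (proj₁ (d-dist x y))

    geodesic-shortest : ∀ x y → Shortest Adj (geodesic x y)
    geodesic-shortest x y w = subst (_≤ len Adj w) (sym (geodesic-len x y)) (d-lower w)

    len≡d⇒shortest : ∀ {x y} (w : Walk Adj x y) → len Adj w ≡ d x y → Shortest Adj w
    len≡d⇒shortest w l w' = subst (_≤ len Adj w') (sym l) (d-lower w')

    Dist⇒≡d : ∀ {x y k} → Dist Adj x y k → k ≡ d x y
    Dist⇒≡d {x} {y} ((w , lw) , low) =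
      ≤-antisym (subst (_ ≤_) (geodesic-len x y) (low (geodesic x y))) (subst (d x y ≤_) lw (d-lower w))

    -- A convex subgraph (whose edges are edges of G) is isometric: the
    -- geodesics of G between its vertices lie in it.
    module _ (H : Subgraph V) (E⊆Adj : ∀ a b → EP H a b → Adj a b) (cv : Convex Adj H) where

      forget : ∀ {x y} (w : Walk (EP H) x y) → Σ (Walk Adj x y) λ w' → len Adj w' ≡ len (EP H) w
      forget []      = [] , refl
      forget (e ∷ w) = let (w' , l) = forget w in (E⊆Adj _ _ e ∷ w') , cong suc l

      restrict : ∀ {x y} (w : Walk Adj x y) → WalkIn Adj H w → Σ (Walk (EP H) x y) λ w' → len (EP H) w' ≡ len Adj w
      restrict []      _           = [] , refl
      restrict (_ ∷ w) (_ , e , r) = let (w' , l) = restrict w r in (e ∷ w') , cong suc l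

      geodesic-in : ∀ x y → VP H x → VP H y → Σ (Walk (EP H) x y) λ w → len (EP H) w ≡ d x y
      geodesic-in x y px py =
        let (w , l) = restrict (geodesic x y) (cv x y px py (geodesic x y) (geodesic-shortest x y))
        in w , trans l (geodesic-len x y)

      convex⇒isometric : Isometric Adj H
      convex⇒isometric x y k px py = mk⇔ to from
        where
        H-geo : Σ (Walk (EP H) x y) λ w → len (EP H) w ≡ d x y
        H-geo = geodesic-in x y px py

        to : Dist (EP H) x y k → Dist Adj x y k
        to ((w , lw) , low) = (proj₁ (forget w) , trans (proj₂ (forget w)) lw) ,
          λ w' → ≤-trans (subst (k ≤_) (proj₂ H-geo) (low (proj₁ H-geo))) (d-lower w')

        from : Dist Adj x y k → Dist (EP H) x y k
        from dist = (proj₁ H-geo , trans (proj₂ H-geo) (sym (Dist⇒≡d dist))) ,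
          λ w → subst (k ≤_) (proj₂ (forget w)) (proj₂ dist (proj₁ (forget w)))

-- Rotating and reflecting
-- such a sequence does not change the underlying subgraph, which lets us
-- put any vertex and either orientation at index 0.
module PeriodicCycles {V : Set} (Adj : V → V → Set) (adj-sym : ∀ x y → Adj x y → Adj y x) where

  UP : V → V → V → V → Set
  UP = UPair {V} {Adj}

  UP-swap : ∀ {a b p q} → UP a b p q → UP a b q p
  UP-swap (inj₁ e) = inj₂ e
  UP-swap (inj₂ e) = inj₁ e

  UP-subst : ∀ {a b p q p' q'} → p ≡ p' → q ≡ q' → UP a b p q → UP a b p' q'
  UP-subst refl refl x = x

  record PCycle (c : ℕ) : Set where
    open Modular c
    field
      u      : ℕ → V
      u-resp : ∀ {x y} → x ≈ y → u x ≡ u y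
      u-inj  : ∀ {x y} → u x ≡ u y → x ≈ y
      u-adj  : ∀ i → Adj (u i) (u (suc i))

  pSub : ∀ {c} → PCycle c → Subgraph V
  pSub s = record { VP = λ v → ∃ λ i → PCycle.u s i ≡ v
                  ; EP = λ a b → ∃ λ i → UP a b (PCycle.u s i) (PCycle.u s (suc i)) }

  module _ {c : ℕ} where
    open Modular c

    rotate : PCycle c → ℕ → PCycle c
    rotate s a = record { u = λ i → u (i + a) ; u-resp = λ e → u-resp (+-congʳ a e)
                        ; u-inj = λ e → cancelʳ a (u-inj e) ; u-adj = λ i → u-adj (i + a) }
      where open PCycle s

    rotate-same : ∀ (s : PCycle c) a → SameSub (pSub (rotate s a)) (pSub s)
    rotate-same s a =
      (λ v → mk⇔ (λ (i , e) → i + a , e) (λ (j , e) → j + c * a , trans (u-resp (rotate-back a j)) e)) ,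
      (λ x y → mk⇔ (λ (i , e) → i + a , e)
                   (λ (j , e) → j + c * a , UP-subst (sym (u-resp (rotate-back a j)))
                                                    (sym (u-resp (suc-cong (rotate-back a j)))) e))
      where open PCycle s

    reflect : PCycle c → PCycle c
    reflect s = record { u = λ i → u (c * i) ; u-resp = λ e → u-resp (*-congˡ c e)
                       ; u-inj = λ e → neg-injective (u-inj e)
                       ; u-adj = λ i → subst (λ z → Adj z (u (c * suc i))) (sym (u-resp (neg-step i)))
                                             (adj-sym _ _ (u-adj (c * suc i))) }
      where open PCycle s

    reflect-same : ∀ (s : PCycle c) → SameSub (pSub (reflect s)) (pSub s)
    reflect-same s =
      (λ v → mk⇔ (λ (i , e) → c * i , e) (λ (j , e) → c * j , trans (u-resp (neg-neg j)) e)) ,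
      (λ x y → mk⇔ (λ (i , e) → c * suc i , UP-subst refl (u-resp (neg-step i)) (UP-swap e))
                   (λ (j , e) → c * suc j , UP-subst (sym (u-resp (neg-neg (suc j)))) (sym (u-resp (neg-suc-neg ≈-refl))) (UP-swap e)))
      where open PCycle s

  module FromCycle (D : Cycle Adj) where
    c : ℕ
    c = 2 + k D
    open Modular c

    index : ℕ → Fin N
    index i = fromℕ< (%<N i)

    u : ℕ → V
    u i = vert D (index i)

    u≡vert : ∀ (x : Fin N) i → toℕ x ≡ i % N → u i ≡ vert D x
    u≡vert x i e = cong (vert D) (toℕ-injective (trans (toℕ-fromℕ< (%<N i)) (sym e)))

    u-toℕ : ∀ (x : Fin N) → u (toℕ x) ≡ vert D x
    u-toℕ x = u≡vert x (toℕ x) (sym (m<n⇒m%n≡m (toℕ<n x)))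

    edge : ∀ i → (∃ λ (j : Fin c) → u i ≡ vert D (inject₁ j) × u (suc i) ≡ vert D (suc j))
                 ⊎ (u i ≡ vert D (fromℕ c) × u (suc i) ≡ vert D zero)
    edge i with edge-index i
    ... | inj₁ (j , e₁ , e₂) = inj₁ (j , u≡vert (inject₁ j) i (trans (toℕ-inject₁ j) e₁) , u≡vert (suc j) (suc i) e₂)
    ... | inj₂ (e₁ , e₂)     = inj₂ (u≡vert (fromℕ c) i (trans (toℕ-fromℕ c) (sym e₁)) , u≡vert zero (suc i) (sym e₂))

    pcycle : PCycle c
    pcycle = record
      { u      = u
      ; u-resp = λ {x} {y} e → u≡vert (index y) x (trans (toℕ-fromℕ< (%<N y)) (sym (un e)))
      ; u-inj  = λ {x} {y} e → mk (trans (sym (toℕ-fromℕ< (%<N x))) (trans (cong toℕ (injv D e)) (toℕ-fromℕ< (%<N y))))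
      ; u-adj  = adj
      }
      where
      adj : ∀ i → Adj (u i) (u (suc i))
      adj i with edge i
      ... | inj₁ (j , e₁ , e₂) = subst₂ Adj (sym e₁) (sym e₂) (step D j)
      ... | inj₂ (e₁ , e₂)     = subst₂ Adj (sym e₁) (sym e₂) (closing D)

    same : SameSub (asSub D) (pSub pcycle)
    same = (λ v → mk⇔ (λ (x , e) → toℕ x , trans (u-toℕ x) e) (λ (i , e) → index i , e)) ,
           (λ a b → mk⇔ to (from a b))
      where
      to : ∀ {a b} → CycE D a b → EP (pSub pcycle) a b
      to (inj₁ (j , up)) = toℕ j , UP-subst (sym inner) (sym (u-toℕ (suc j))) up
        where
        inner : u (toℕ j) ≡ vert D (inject₁ j)
        inner = trans (cong u (sym (toℕ-inject₁ j))) (u-toℕ (inject₁ j))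
      to (inj₂ up)       = c , UP-subst (sym last) (sym (u≡vert zero (suc c) (sym (n%n≡0 N)))) up
        where
        last : u c ≡ vert D (fromℕ c)
        last = trans (cong u (sym (toℕ-fromℕ c))) (u-toℕ (fromℕ c))
      from : ∀ a b → EP (pSub pcycle) a b → CycE D a b
      from a b (i , up) with edge i
      ... | inj₁ (j , e₁ , e₂) = inj₁ (j , UP-subst e₁ e₂ up)
      ... | inj₂ (e₁ , e₂)     = inj₂ (UP-subst e₁ e₂ up)

  module ToCycle {k : ℕ} (s : PCycle (2 + k)) where
    c : ℕ
    c = 2 + k
    open Modular c
    open PCycle s

    cycle : Cycle Adj
    cycle = record
      { k       = k
      ; vert    = λ i → u (toℕ i)
      ; injv    = λ e → toℕ-injective (≈⇒≡ (toℕ<n _) (toℕ<n _) (u-inj e))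
      ; step    = λ i → subst (λ z → Adj (u z) (u (suc (toℕ i)))) (sym (toℕ-inject₁ i)) (u-adj (toℕ i))
      ; closing = subst₂ (λ z w → Adj (u z) w) (sym (toℕ-fromℕ c)) (u-resp (+N 0)) (u-adj c)
      }

    same : SameSub (asSub cycle) (pSub s)
    same = (λ v → mk⇔ (λ (x , e) → toℕ x , e)
                      (λ (i , e) → fromℕ< (%<N i) , trans (u-resp (≈-trans (≡⇒≈ (toℕ-fromℕ< (%<N i))) (%≈ i))) e)) ,
           (λ a b → mk⇔ to (from a b))
      where
      to : ∀ {a b} → CycE cycle a b → EP (pSub s) a b
      to (inj₁ (j , up)) = toℕ j , UP-subst (cong u (toℕ-inject₁ j)) refl up
      to (inj₂ up)       = c , UP-subst (cong u (toℕ-fromℕ c)) (u-resp (≈-sym (+N 0))) up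
      mod : ∀ i {x} → toℕ x ≡ i % N → u i ≡ u (toℕ x)
      mod i e = u-resp (≈-trans (≈-sym (%≈ i)) (≡⇒≈ (sym e)))
      from : ∀ a b → EP (pSub s) a b → CycE cycle a b
      from a b (i , up) with edge-index i
      ... | inj₁ (j , e₁ , e₂) = inj₁ (j , UP-subst (mod i (trans (toℕ-inject₁ j) e₁)) (mod (suc i) {suc j} e₂) up)
      ... | inj₂ (e₁ , e₂)     = inj₂ (UP-subst (mod i (trans (toℕ-fromℕ c) (sym e₁))) (mod (suc i) {zero} (sym e₂)) up)

module ConvexCycles {V : Set} (Adj : V → V → Set) (adj-sym : ∀ x y → Adj x y → Adj y x)
                    (irr : ∀ x → ¬ Adj x x) (M : BipartiteMetric Adj) where
  open BipartiteMetric M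
  open Subgraphs Adj
  open Geodesics d d-dist
  open PeriodicCycles Adj adj-sym

  along : (w : ℕ → V) → (∀ i → Adj (w i) (w (suc i))) → ∀ j → Walk Adj (w 0) (w j)
  along w adj zero    = []
  along w adj (suc j) = adj 0 ∷ along (λ i → w (suc i)) (λ i → adj (suc i)) j

  along-len : ∀ w adj j → len Adj (along w adj j) ≡ j
  along-len w adj zero    = refl
  along-len w adj (suc j) = cong suc (along-len (λ i → w (suc i)) (λ i → adj (suc i)) j)

  along-in : ∀ (H : Subgraph V) w adj j → WalkIn Adj H (along w adj j) → ∀ i → i ≤ j → VP H (w i)
  along-in H w adj zero    p       zero    z≤n       = p
  along-in H w adj (suc j) (p , _) zero    _         = p
  along-in H w adj (suc j) (_ , _ , q) (suc i) (s≤s le) = along-in H (λ i → w (suc i)) (λ i → adj (suc i)) j q i le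

  module _ {c : ℕ} (s : PCycle c) where
    open Modular c
    open PCycle s

    colour-alternates : ∀ i → (∃ λ h → i ≡ h + h × colour (u i) ≡ colour (u 0))
                              ⊎ (∃ λ h → i ≡ suc (h + h) × colour (u i) ≡ not (colour (u 0)))
    colour-alternates zero = inj₁ (0 , refl , refl)
    colour-alternates (suc i) with colour-alternates i
    ... | inj₁ (h , e , p) = inj₂ (h , cong suc e , trans (colour-flip (u-adj i)) (cong not p))
    ... | inj₂ (h , e , p) = inj₁ (suc h , trans (cong suc e) (cong suc (sym (+-suc h h))) ,
                                   trans (colour-flip (u-adj i)) (trans (cong not p) (not-involutive _)))

    even-length : ∃ λ L → N ≡ L + L
    even-length with colour-alternates N
    ... | inj₁ (L , e , _) = L , e
    ... | inj₂ (_ , _ , p) = ⊥-elim (not-¬ refl (trans (sym (cong colour (u-resp (+N 0)))) p))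

    arc : ∀ a j → Walk Adj (u a) (u (j + a))
    arc a j = along (λ i → u (i + a)) (λ i → u-adj (i + a)) j

    arc-len : ∀ a j → len Adj (arc a j) ≡ j
    arc-len a j = along-len (λ i → u (i + a)) (λ i → u-adj (i + a)) j

    Displaced : ℕ → ℕ → ℕ → Set
    Displaced a b ℓ = ∃ λ j → j ≤ ℓ × (a + j ≈ b ⊎ b + j ≈ a)

    displaced-forward : ∀ {a q b ℓ} → q ≈ suc a → Displaced q b ℓ → Displaced a b (suc ℓ)
    displaced-forward {a} qa (j , le , inj₁ r) =
      suc j , s≤s le , inj₁ (≈-trans (≡⇒≈ (+-suc a j)) (≈-trans (+-congʳ j (≈-sym qa)) r))
    displaced-forward {a} {b = b} qa (zero , _ , inj₂ r) =
      1 , s≤s z≤n , inj₁ (≈-trans (≡⇒≈ (+-comm a 1)) (≈-sym (≈-trans (≡⇒≈ (sym (+-identityʳ b))) (≈-trans r qa))))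
    displaced-forward {b = b} qa (suc j , le , inj₂ r) =
      j , ≤-trans (n≤1+n j) (≤-trans le (n≤1+n _)) , inj₂ (cancelˡ 1 (≈-trans (≡⇒≈ (sym (+-suc b j))) (≈-trans r qa)))

    displaced-backward : ∀ {a q b ℓ} → a ≈ suc q → Displaced q b ℓ → Displaced a b (suc ℓ)
    displaced-backward {q = q} {b} aq (zero , _ , inj₁ r) =
      1 , s≤s z≤n , inj₂ (≈-trans (≡⇒≈ (+-comm b 1)) (≈-sym (≈-trans aq (suc-cong (≈-trans (≡⇒≈ (sym (+-identityʳ q))) r)))))
    displaced-backward {q = q} aq (suc j , le , inj₁ r) =
      j , ≤-trans (n≤1+n j) (≤-trans le (n≤1+n _)) , inj₁ (≈-trans (+-congʳ j aq) (≈-trans (≡⇒≈ (sym (+-suc q j))) r))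
    displaced-backward {b = b} aq (j , le , inj₂ r) =
      suc j , s≤s le , inj₂ (≈-trans (≡⇒≈ (+-suc b j)) (≈-trans (suc-cong r) (≈-sym aq)))

    walk-displacement : ∀ {x y} (w : Walk Adj x y) → WalkIn Adj (pSub s) w →
                        ∀ a b → u a ≡ x → u b ≡ y → Displaced a b (len Adj w)
    walk-displacement [] _ a b ea eb = 0 , z≤n , inj₁ (≈-trans (≡⇒≈ (+-identityʳ a)) (u-inj (trans ea (sym eb))))
    walk-displacement (_ ∷ w) (_ , (p , up) , rest) a b ea eb
      with walk-start (pSub s) w rest
    ... | q , eq with walk-displacement w rest q b eq eb | up
    ...   | rec | inj₁ (e₁ , e₂) = displaced-forward  (≈-trans (u-inj (trans eq e₂)) (suc-cong (≈-sym (u-inj (trans ea e₁))))) rec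
    ...   | rec | inj₂ (e₁ , e₂) = displaced-backward (≈-trans (u-inj (trans ea e₁)) (suc-cong (≈-sym (u-inj (trans eq e₂))))) rec

    cycle-neighbour : Convex Adj (pSub s) → ∀ p x → VP (pSub s) x → Adj (u p) x →
                      x ≡ u (suc p) ⊎ ∃ λ q → x ≡ u q × suc q ≈ p
    cycle-neighbour cvs p x px e with convex-induced irr (pSub s) cvs (p , refl) px e
    ... | i , inj₁ (e₁ , e₂) = inj₁ (trans e₂ (u-resp (suc-cong (≈-sym (u-inj e₁)))))
    ... | i , inj₂ (e₁ , e₂) = inj₂ (i , e₂ , u-inj (sym e₁))

    orient : Convex Adj (pSub s) → ∀ {x y} → VP (pSub s) x → VP (pSub s) y → Adj x y →
             ∃ λ s′ → SameSub (pSub s′) (pSub s) × PCycle.u s′ 0 ≡ x × PCycle.u s′ 1 ≡ y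
    orient cvs {x} {y} (p , up≡x) py e with cycle-neighbour cvs p y py (subst (λ z → Adj z y) (sym up≡x) e)
    ... | inj₁ y≡next = rotate s p , rotate-same s p , up≡x , sym y≡next
    ... | inj₂ (q , y≡uq , q+1≈p) =
      rotate (reflect s) (c * p) , SameSub-trans (rotate-same (reflect s) (c * p)) (reflect-same s) ,
      trans (u-resp (neg-neg p)) up≡x , trans (u-resp (neg-suc-neg q+1≈p)) (sym y≡uq)

    module HalfLength (cvs : Convex Adj (pSub s)) (L : ℕ) (N≡2L : N ≡ L + L) where

      1≤L : 1 ≤ L
      1≤L = positive L N≡2L
        where
        positive : ∀ L → N ≡ L + L → 1 ≤ L
        positive zero    ()
        positive (suc _) _ = s≤s z≤n

      ≤L⇒<N : ∀ {j} → j ≤ L → j < N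
      ≤L⇒<N {j} le = subst (j <_) (sym N≡2L) (≤-trans (s≤s le) (+-monoˡ-≤ L 1≤L))

      arc-distance : ∀ a j → j ≤ L → d (u a) (u (j + a)) ≡ j
      arc-distance a j j≤L = ≤-antisym d≤j j≤d
        where
        g : Walk Adj (u a) (u (j + a))
        g = geodesic (u a) (u (j + a))
        d≤j : d (u a) (u (j + a)) ≤ j
        d≤j = subst (_ ≤_) (arc-len a j) (d-lower (arc a j))
        j≤d : j ≤ d (u a) (u (j + a))
        j≤d with walk-displacement g (cvs _ _ (a , refl) (j + a , refl) g (geodesic-shortest _ _)) a (j + a) refl refl
        ... | j' , j'≤g , r with j ≤? j'
        ...   | yes j≤j' = ≤-trans j≤j' (subst (j' ≤_) (geodesic-len _ _) j'≤g)
        ...   | no j≰j' with r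
        ...     | inj₁ r = ⊥-elim (j≰j' (≤-reflexive (sym j'≡j)))
          where
          j'≡j : j' ≡ j
          j'≡j = ≈⇒≡ (≤-<-trans (<⇒≤ (≰⇒> j≰j')) (≤L⇒<N j≤L)) (≤L⇒<N j≤L) (cancelˡ a (≈-trans r (≡⇒≈ (+-comm j a))))
        ...     | inj₂ r = subst (_≤ d (u a) (u (j + a))) (sym j≡0) z≤n
          where
          j+j'<N : j + j' < N
          j+j'<N = subst (j + j' <_) (sym N≡2L) (≤-trans (+-monoʳ-< j (≰⇒> j≰j')) (+-mono-≤ j≤L j≤L))
          j+j'≈0 : j + j' ≈ 0
          j+j'≈0 = cancelʳ a (≈-trans (≡⇒≈ (trans (+-assoc j j' a) (trans (cong (j +_) (+-comm j' a)) (sym (+-assoc j a j'))))) r)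
          j≡0 : j ≡ 0
          j≡0 = m+n≡0⇒m≡0 j (≈⇒≡ j+j'<N (s≤s z≤n) j+j'≈0)

      arc-shortest : ∀ a j → j ≤ L → Shortest Adj (arc a j)
      arc-shortest a j j≤L = len≡d⇒shortest (arc a j) (trans (arc-len a j) (sym (arc-distance a j j≤L)))

      arc-in-convex : ∀ (H : Subgraph V) → Convex Adj H → ∀ a j → j ≤ L →
                      VP H (u a) → VP H (u (j + a)) → ∀ i → i ≤ j → VP H (u (i + a))
      arc-in-convex H cvH a j j≤L pa pb =
        along-in H (λ i → u (i + a)) (λ i → u-adj (i + a)) j (cvH _ _ pa pb (arc a j) (arc-shortest a j j≤L))

module Threshold {P : ℕ → Set} (P? : ∀ i → Dec (P i)) where

  prefix : P 0 → ∀ n → (∀ i → i ≤ n → P i) ⊎ ∃ λ m → (∀ i → i ≤ m → P i) × ¬ P (suc m)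
  prefix p₀ zero = inj₁ (λ { _ z≤n → p₀ })
  prefix p₀ (suc n) with prefix p₀ n | P? (suc n)
  ... | inj₂ found | _     = inj₂ found
  ... | inj₁ all   | no ¬p = inj₂ (n , all , ¬p)
  ... | inj₁ all   | yes p = inj₁ all′
    where
    all′ : ∀ i → i ≤ suc n → P i
    all′ i le with m≤n⇒m<n∨m≡n le
    ... | inj₁ (s≤s i≤n) = all i i≤n
    ... | inj₂ refl      = p

  first-failure : P 0 → ∀ n → ¬ P n → ∃ λ m → (∀ i → i ≤ m → P i) × ¬ P (suc m)
  first-failure p₀ n ¬pn with prefix p₀ n
  ... | inj₁ all   = ⊥-elim (¬pn (all n ≤-refl))
  ... | inj₂ found = found

  switch-on : ∀ b r → ¬ P b → P (r + b) → ∃ λ q → ¬ P (q + b) × P (suc q + b)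
  switch-on b zero    ¬pb pb = ⊥-elim (¬pb pb)
  switch-on b (suc r) ¬pb pb with P? (r + b)
  ... | yes p = switch-on b r ¬pb p
  ... | no ¬p = r , ¬p , pb

module Intersection {V : Set} (Adj : V → V → Set) (adj-sym : ∀ x y → Adj x y → Adj y x)
                    (irr : ∀ x → ¬ Adj x x) (M : BipartiteMetric Adj) where
  open BipartiteMetric M
  open Subgraphs Adj
  open PeriodicCycles Adj adj-sym
  open ConvexCycles Adj adj-sym irr M

  module Arc {c : ℕ} (s : PCycle c) (cvs : Convex Adj (pSub s))
             (H : Subgraph V) (cvH : Convex Adj H) (H? : ∀ x → Dec (VP H x))
             (start-in : VP H (PCycle.u s 0)) (end-out : ¬ VP H (PCycle.u s c)) where
    open Modular c
    open PCycle s

    L : ℕ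
    L = proj₁ (even-length s)

    N≡2L : N ≡ L + L
    N≡2L = proj₂ (even-length s)

    open HalfLength s cvs L N≡2L

    first : ∃ λ m → (∀ i → i ≤ m → VP H (u i)) × ¬ VP H (u (suc m))
    first = Threshold.first-failure (λ i → H? (u i)) start-in c end-out

    m : ℕ
    m = proj₁ first

    prefix-in : ∀ i → i ≤ m → VP H (u i)
    prefix-in = proj₁ (proj₂ first)

    next-out : ¬ VP H (u (suc m))
    next-out = proj₂ (proj₂ first)

    u+0 : ∀ j → u (j + 0) ≡ u j
    u+0 j = cong u (+-identityʳ j)

    N-in : VP H (u N)
    N-in = subst (VP H) (u-resp (≈-sym (+N 0))) start-in

    -- Past the arc, no vertex of the cycle is in H: a short way back to
    -- u 0 or forward to u N would run through u (m + 1) or u c.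
    beyond-out : ∀ j → suc m ≤ j → j ≤ c → ¬ VP H (u j)
    beyond-out j m<j j≤c pj with j ≤? L
    ... | yes j≤L = next-out (subst (VP H) (u+0 (suc m))
                      (arc-in-convex H cvH 0 j j≤L start-in (subst (VP H) (sym (u+0 j)) pj) (suc m) m<j))
    ... | no  j≰L = end-out (subst (VP H) (cong u (m∸n+n≡m j≤c))
                      (arc-in-convex H cvH j r r≤L pj (subst (VP H) (cong u (sym r+j≡N)) N-in) (c ∸ j) (∸-monoˡ-≤ j (n≤1+n c))))
      where
      r : ℕ
      r = N ∸ j
      r+j≡N : r + j ≡ N
      r+j≡N = m∸n+n≡m (≤-trans j≤c (n≤1+n c))
      r≤L : r ≤ L
      r≤L = +-cancelʳ-≤ j r L (≤-trans (≤-reflexive (trans r+j≡N N≡2L)) (+-monoʳ-≤ L (<⇒≤ (≰⇒> j≰L))))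

    common-in-arc : ∀ v → VP (pSub s) v → VP H v → ∃ λ i → i ≤ m × v ≡ u i
    common-in-arc v (i , e) pv with i % N ≤? m
    ... | yes le = i % N , le , trans (sym e) (u-resp (≈-sym (%≈ i)))
    ... | no  nle = ⊥-elim (beyond-out (i % N) (≰⇒> nle) (≤-pred (%<N i)) (subst (VP H) (sym (trans (u-resp (%≈ i)) e)) pv))

    -- The arc is shorter than half the cycle: otherwise H would contain the
    -- geodesic arc from u L to u N = u 0 and hence u c.
    m<L : m < L
    m<L with m <? L
    ... | yes m<L = m<L
    ... | no  m≮L = ⊥-elim (end-out (subst (VP H) (cong u L-1+L≡c)
                      (arc-in-convex H cvH L L ≤-refl (prefix-in L (≮⇒≥ m≮L)) (subst (VP H) (cong u N≡2L) N-in) (L ∸ 1) (m∸n≤m L 1))))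
      where
      L-1+L≡c : (L ∸ 1) + L ≡ c
      L-1+L≡c = suc-injective (trans (cong (_+ L) (trans (+-comm 1 (L ∸ 1)) (m∸n+n≡m 1≤L))) (sym N≡2L))

    arc-common : ∀ i → i ≤ m → VP (pSub s) (u i) × VP H (u i)
    arc-common i le = (i , refl) , prefix-in i le

    m≢0 : ¬ MeetInVertex (pSub s) H → m ≢ 0
    m≢0 ¬V m≡0 = ¬V (u 0 , λ v → mk⇔ (λ (p₁ , p₂) → only-u₀ v p₁ p₂) (λ { refl → arc-common 0 z≤n }))
      where
      only-u₀ : ∀ v → VP (pSub s) v → VP H v → v ≡ u 0
      only-u₀ v p₁ p₂ = let (i , le , e) = common-in-arc v p₁ p₂ in
        trans e (cong u (n≤0⇒n≡0 (subst (i ≤_) m≡0 le)))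

    m≢1 : ¬ MeetInEdge (pSub s) H → m ≢ 1
    m≢1 ¬E m≡1 = ¬E (u 0 , u 1 , (λ v → mk⇔ (λ (p₁ , p₂) → only-u₀u₁ v p₁ p₂) both) ,
                     (0 , inj₁ (refl , refl)) , convex-induced irr H cvH start-in (prefix-in 1 (≤-reflexive (sym m≡1))) (u-adj 0))
      where
      only-u₀u₁ : ∀ v → VP (pSub s) v → VP H v → v ≡ u 0 ⊎ v ≡ u 1
      only-u₀u₁ v p₁ p₂ with common-in-arc v p₁ p₂
      ... | zero          , _  , e = inj₁ e
      ... | suc zero      , _  , e = inj₂ e
      ... | suc (suc _)   , le , _ = ⊥-elim (<⇒≱ (s≤s (s≤s z≤n)) (subst (_ ≤_) m≡1 le))
      both : ∀ {v} → v ≡ u 0 ⊎ v ≡ u 1 → VP (pSub s) v × VP H v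
      both (inj₁ refl) = arc-common 0 z≤n
      both (inj₂ refl) = arc-common 1 (≤-reflexive (sym m≡1))

    two≤m : ¬ MeetInVertex (pSub s) H → ¬ MeetInEdge (pSub s) H → 2 ≤ m
    two≤m ¬V ¬E with m | m≢0 ¬V | m≢1 ¬E
    ... | zero        | m≢0 | _   = ⊥-elim (m≢0 refl)
    ... | suc zero    | _   | m≢1 = ⊥-elim (m≢1 refl)
    ... | suc (suc _) | _   | _   = s≤s (s≤s z≤n)

    module Alignment {c′ : ℕ} (t : PCycle c′) (t≅H : SameSub (pSub t) H) (2≤m : 2 ≤ m) where
      module M′ = Modular c′

      H⊆t : ∀ v → VP H v → VP (pSub t) v
      H⊆t v = Equivalence.from (proj₁ t≅H v)

      u₁-in : VP H (u 1)
      u₁-in = prefix-in 1 (≤-trans (s≤s z≤n) 2≤m)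

      oriented : ∃ λ t₁ → SameSub (pSub t₁) (pSub t) × PCycle.u t₁ 0 ≡ u 0 × PCycle.u t₁ 1 ≡ u 1
      oriented = orient t (Convex-transfer (SameSub-sym t≅H) cvH) (H⊆t _ start-in) (H⊆t _ u₁-in) (u-adj 0)

      t₁ : PCycle c′
      t₁ = proj₁ oriented

      open PCycle t₁ using () renaming (u to w; u-resp to w-resp; u-inj to w-inj)

      t₁≅H : SameSub (pSub t₁) H
      t₁≅H = SameSub-trans (proj₁ (proj₂ oriented)) t≅H

      cvt₁ : Convex Adj (pSub t₁)
      cvt₁ = Convex-transfer (SameSub-sym t₁≅H) cvH

      2<N : 2 < N
      2<N = ≤-trans (s≤s 2≤m) (≤-trans m<L (subst (L ≤_) (sym N≡2L) (m≤m+n L L)))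

      -- t₁ follows s step by step along the arc: turning back at step i + 1
      -- would give u (i + 2) = u i, impossible as N > 2.
      follow : ∀ i → suc i ≤ m → w i ≡ u i × w (suc i) ≡ u (suc i)
      follow zero _ = proj₁ (proj₂ (proj₂ oriented)) , proj₂ (proj₂ (proj₂ oriented))
      follow (suc i) le with follow i (≤-trans (n≤1+n _) le)
      ... | wi≡ui , wi+1≡ui+1
        with cycle-neighbour t₁ cvt₁ (suc i) (u (suc (suc i)))
               (Equivalence.from (proj₁ t₁≅H _) (prefix-in _ le))
               (subst (λ z → Adj z (u (suc (suc i)))) (sym wi+1≡ui+1) (u-adj (suc i)))
      ...   | inj₁ next = wi+1≡ui+1 , sym next
      ...   | inj₂ (q , ui+2≡wq , q+1≈i+1) = ⊥-elim (contradiction (≈⇒≡ 2<N (s≤s z≤n) 2≈0) λ ())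
        where
        2≈0 : 2 ≈ 0
        2≈0 = cancelʳ i (u-inj (trans ui+2≡wq (trans (w-resp (M′.cancelˡ 1 q+1≈i+1)) wi≡ui)))

      agree : ∀ i → i ≤ m → u i ≡ w i
      agree zero    _  = sym (proj₁ (proj₂ (proj₂ oriented)))
      agree (suc i) le = sym (proj₂ (follow i le))

      K : ℕ
      K = proj₁ (even-length t₁)

      N′≡2K : M′.N ≡ K + K
      N′≡2K = proj₂ (even-length t₁)

      module T₁ = HalfLength t₁ cvt₁ K N′≡2K

      -- The common arc is at most half of t₁: otherwise u 0 and u (K + 1)
      -- would be at distance K + 1 along s but K − 1 along t₁.
      m≤K : m ≤ K
      m≤K with m ≤? K
      ... | yes m≤K = m≤K
      ... | no  m≰K = ⊥-elim (<⇒≱ (s≤s (m∸n≤m K 1)) (≤-reflexive K+1≡K-1))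
        where
        K<m : suc K ≤ m
        K<m = ≰⇒> m≰K
        back-to-0 : w ((K ∸ 1) + suc K) ≡ u 0
        back-to-0 = trans (cong w (trans (+-suc (K ∸ 1) K) (trans (cong (_+ K) (trans (+-comm 1 (K ∸ 1)) (m∸n+n≡m T₁.1≤L))) (sym N′≡2K))))
                          (trans (w-resp (M′.+N 0)) (sym (agree 0 z≤n)))
        K+1≡K-1 : suc K ≡ K ∸ 1
        K+1≡K-1 = begin
          suc K                                   ≡⟨ arc-distance 0 (suc K) (≤-trans K<m (<⇒≤ m<L)) ⟨
          d (u 0) (u (suc K + 0))                 ≡⟨ d-sym _ _ ⟩
          d (u (suc K + 0)) (u 0)                 ≡⟨ cong₂ d (trans (u+0 (suc K)) (agree (suc K) K<m)) (sym back-to-0) ⟩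
          d (w (suc K)) (w ((K ∸ 1) + suc K))     ≡⟨ T₁.arc-distance (suc K) (K ∸ 1) (m∸n≤m K 1) ⟩
          K ∸ 1                                   ∎
          where open ≡-Reasoning

      separate : ∀ i j → i < N → j < M′.N → u i ≡ w j → i ≤ m × j ≤ m
      separate i j i<N j<N′ ui≡wj with i ≤? m
      ... | no  i≰m = ⊥-elim (beyond-out i (≰⇒> i≰m) (≤-pred i<N) (Equivalence.to (proj₁ t₁≅H (u i)) (j , sym ui≡wj)))
      ... | yes i≤m = i≤m , subst (_≤ m) (sym j≡i) i≤m
        where
        i<N′ : i < M′.N
        i<N′ = ≤-trans (s≤s (≤-trans i≤m m≤K)) (subst (suc K ≤_) (sym N′≡2K) (+-monoˡ-≤ K T₁.1≤L))
        j≡i : j ≡ i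
        j≡i = M′.≈⇒≡ j<N′ i<N′ (w-inj (trans (sym ui≡wj) (agree i i≤m)))

double-split : ∀ {m L} → m ≤ L → L + L ≡ 2 * m + 2 * (L ∸ m)
double-split {m} {L} m≤L = begin
  L + L                               ≡⟨ cong (λ z → z + z) (m+[n∸m]≡n m≤L) ⟨
  (m + (L ∸ m)) + (m + (L ∸ m))       ≡⟨ cong ((m + (L ∸ m)) +_) (+-identityʳ _) ⟨
  2 * (m + (L ∸ m))                   ≡⟨ *-distribˡ-+ 2 m (L ∸ m) ⟩
  2 * m + 2 * (L ∸ m)                 ∎
  where open ≡-Reasoning

module Intertwining {n : ℕ} (Adj : Fin n → Fin n → Set) (adj-sym : ∀ x y → Adj x y → Adj y x)
                    (irr : ∀ x → ¬ Adj x x) (M : BipartiteMetric Adj) where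
  open import Data.Fin using () renaming (_≟_ to _≟ᶠ_)
  open import Data.Fin.Properties using (any?; all?; ¬∀⟶∃¬)
  open BipartiteMetric M
  open Subgraphs Adj
  open Geodesics d d-dist
  open PeriodicCycles Adj adj-sym
  open Intersection Adj adj-sym irr M

  cycle-vertex? : ∀ (D : Cycle Adj) x → Dec (CycV D x)
  cycle-vertex? D x = any? (λ i → vert D i ≟ᶠ x)

  cycle-edge⇒Adj : ∀ (D : Cycle Adj) a b → CycE D a b → Adj a b
  cycle-edge⇒Adj D a b (inj₁ (j , inj₁ (refl , refl))) = step D j
  cycle-edge⇒Adj D a b (inj₁ (j , inj₂ (refl , refl))) = adj-sym _ _ (step D j)
  cycle-edge⇒Adj D a b (inj₂ (inj₁ (refl , refl)))     = closing D
  cycle-edge⇒Adj D a b (inj₂ (inj₂ (refl , refl)))     = adj-sym _ _ (closing D)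

  cycle-edge-ends : ∀ (D : Cycle Adj) {a b} → CycE D a b → CycV D a × CycV D b
  cycle-edge-ends D (inj₁ (j , inj₁ (refl , refl))) = (_ , refl) , (_ , refl)
  cycle-edge-ends D (inj₁ (j , inj₂ (refl , refl))) = (_ , refl) , (_ , refl)
  cycle-edge-ends D (inj₂ (inj₁ (refl , refl)))     = (_ , refl) , (_ , refl)
  cycle-edge-ends D (inj₂ (inj₂ (refl , refl)))     = (_ , refl) , (_ , refl)

  convex-cycle-isometric : ∀ (D : Cycle Adj) → Convex Adj (asSub D) → Isometric Adj (asSub D)
  convex-cycle-isometric D = convex⇒isometric (asSub D) (cycle-edge⇒Adj D)

  -- Convex cycles are induced, so equal vertex sets make them equal.
  same-vertices⇒same : ∀ (D₁ D₂ : Cycle Adj) → Convex Adj (asSub D₁) → Convex Adj (asSub D₂) →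
                       (∀ i → CycV D₂ (vert D₁ i)) → (∀ i → CycV D₁ (vert D₂ i)) → SameSub (asSub D₁) (asSub D₂)
  same-vertices⇒same D₁ D₂ cv₁ cv₂ D₁⊆D₂ D₂⊆D₁ =
    (λ v → mk⇔ (⊆ D₁ D₂ D₁⊆D₂ v) (⊆ D₂ D₁ D₂⊆D₁ v)) ,
    (λ a b → mk⇔ (edges D₁ D₂ cv₂ D₁⊆D₂ a b) (edges D₂ D₁ cv₁ D₂⊆D₁ a b))
    where
    ⊆ : ∀ D D′ → (∀ i → CycV D′ (vert D i)) → ∀ v → CycV D v → CycV D′ v
    ⊆ D D′ D⊆D′ v (i , e) = subst (CycV D′) e (D⊆D′ i)
    edges : ∀ D D′ → Convex Adj (asSub D′) → (∀ i → CycV D′ (vert D i)) → ∀ a b → CycE D a b → CycE D′ a b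
    edges D D′ cv′ D⊆D′ a b e = let (pa , pb) = cycle-edge-ends D e in
      convex-induced irr (asSub D′) cv′ (⊆ D D′ D⊆D′ a pa) (⊆ D D′ D⊆D′ b pb) (cycle-edge⇒Adj D a b e)

  Intertwine-sym : ∀ {D₁ D₂ : Cycle Adj} → Intertwine D₂ D₁ → Intertwine D₁ D₂
  Intertwine-sym (I₂ , I₁ , m , n₂ , n₁ , E₂ , E₁ , 2≤m , S₂ , S₁ , ℓ₂ , ℓ₁ , agree , separate) =
    I₁ , I₂ , m , n₁ , n₂ , E₁ , E₂ , 2≤m , S₁ , S₂ , ℓ₁ , ℓ₂ ,
    (λ i j e le → sym (agree j i (sym e) (subst (_≤ m) e le))) ,
    (λ i j e → swap (separate j i (sym e)))

  entry-index : ∀ (D₁ D₂ : Cycle Adj) → (∃ λ b → ¬ CycV D₂ (vert D₁ b)) → (∃ λ v → Common D₁ D₂ v) →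
    ∃ λ a → CycV D₂ (PCycle.u (FromCycle.pcycle D₁) a)
          × ¬ CycV D₂ (PCycle.u (FromCycle.pcycle D₁) (FromCycle.c D₁ + a))
  entry-index D₁ D₂ (b , b-out) (v , (i , vi≡v) , v-in) = suc q + toℕ b , q+1-in , end-out
    where
    open FromCycle D₁ using (c; u-toℕ; pcycle)
    open Modular c
    open PCycle pcycle using (u; u-resp)
    -- index i, where D₁ is in D₂, is congruent to (i − b) + b
    i-in : CycV D₂ (u ((toℕ i + c * toℕ b) + toℕ b))
    i-in = subst (CycV D₂) (sym (trans (u-resp (rotate-back (toℕ b) (toℕ i))) (trans (u-toℕ i) vi≡v))) v-in
    switch : ∃ λ q → ¬ CycV D₂ (u (q + toℕ b)) × CycV D₂ (u (suc q + toℕ b))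
    switch = Threshold.switch-on (λ j → cycle-vertex? D₂ (u j)) (toℕ b) (toℕ i + c * toℕ b)
               (λ p → b-out (subst (CycV D₂) (u-toℕ b) p)) i-in
    q : ℕ
    q = proj₁ switch
    q+1-in : CycV D₂ (u (suc q + toℕ b))
    q+1-in = proj₂ (proj₂ switch)
    end-out : ¬ CycV D₂ (u (c + (suc q + toℕ b)))
    end-out p = proj₁ (proj₂ switch) (subst (CycV D₂) (u-resp (≈-trans (≡⇒≈ c+a≡q+b+N) (+N (q + toℕ b)))) p)
      where
      c+a≡q+b+N : c + (suc q + toℕ b) ≡ q + toℕ b + N
      c+a≡q+b+N = trans (+-suc c (q + toℕ b)) (+-comm N (q + toℕ b))

  intertwine-if-not-contained : ∀ (D₁ D₂ : Cycle Adj) → Convex Adj (asSub D₁) → Convex Adj (asSub D₂) →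
    (∃ λ b → ¬ CycV D₂ (vert D₁ b)) → (∃ λ v → Common D₁ D₂ v) →
    ¬ IntVertex D₁ D₂ → ¬ IntEdge D₁ D₂ → Intertwine D₁ D₂
  intertwine-if-not-contained D₁ D₂ cv₁ cv₂ outside common ¬V ¬E =
    convex-cycle-isometric D₁ cv₁ , convex-cycle-isometric D₂ cv₂ ,
    m , L ∸ m , K ∸ m , ToCycle.cycle s₁ , ToCycle.cycle t₁ , 2≤m ,
    SameSub-trans (ToCycle.same s₁) (SameSub-sym D₁≅s₁) ,
    SameSub-trans (ToCycle.same t₁) t₁≅H ,
    trans N≡2L (double-split (<⇒≤ m<L)) , trans N′≡2K (double-split m≤K) ,
    (λ i j e le → trans (agree (toℕ i) le) (cong (PCycle.u t₁) e)) ,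
    (λ i j e → separate (toℕ i) (toℕ j) (toℕ<n i) (toℕ<n j) e)
    where
    entry : ∃ λ a → CycV D₂ (PCycle.u (FromCycle.pcycle D₁) a)
                  × ¬ CycV D₂ (PCycle.u (FromCycle.pcycle D₁) (FromCycle.c D₁ + a))
    entry = entry-index D₁ D₂ outside common
    s₁ : PCycle (FromCycle.c D₁)
    s₁ = rotate (FromCycle.pcycle D₁) (proj₁ entry)
    D₁≅s₁ : SameSub (asSub D₁) (pSub s₁)
    D₁≅s₁ = SameSub-trans (FromCycle.same D₁) (SameSub-sym (rotate-same (FromCycle.pcycle D₁) (proj₁ entry)))
    open Arc s₁ (Convex-transfer D₁≅s₁ cv₁) (asSub D₂) cv₂ (cycle-vertex? D₂) (proj₁ (proj₂ entry)) (proj₂ (proj₂ entry))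
    2≤m : 2 ≤ m
    2≤m = two≤m (λ V → ¬V (vertex-transfer {H₂ = asSub D₂} D₁≅s₁ V)) (λ E → ¬E (edge-transfer {H₂ = asSub D₂} D₁≅s₁ E))
    open Alignment (FromCycle.pcycle D₂) (SameSub-sym (FromCycle.same D₂)) 2≤m

  theorem : (D₁ D₂ : Cycle Adj) → Convex Adj (asSub D₁) → Convex Adj (asSub D₂) →
            ¬ SameSub (asSub D₁) (asSub D₂) → ¬ (IntEmpty D₁ D₂ ⊎ IntVertex D₁ D₂ ⊎ IntEdge D₁ D₂) →
            Intertwine D₁ D₂
  theorem D₁ D₂ cv₁ cv₂ ¬same ¬int with any? (λ i → cycle-vertex? D₂ (vert D₁ i))
  ... | no disjoint = ⊥-elim (¬int (inj₁ λ v ((i , e) , p) → disjoint (i , subst (CycV D₂) (sym e) p)))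
  ... | yes (i₀ , p₀) with all? (λ i → cycle-vertex? D₂ (vert D₁ i)) | all? (λ i → cycle-vertex? D₁ (vert D₂ i))
  ...   | no D₁⊈D₂ | _ =
          intertwine-if-not-contained D₁ D₂ cv₁ cv₂ (¬∀⟶∃¬ _ _ (λ i → cycle-vertex? D₂ (vert D₁ i)) D₁⊈D₂)
            (vert D₁ i₀ , (i₀ , refl) , p₀) (λ V → ¬int (inj₂ (inj₁ V))) (λ E → ¬int (inj₂ (inj₂ E)))
  ...   | yes _ | no D₂⊈D₁ = Intertwine-sym {D₁} {D₂}
          (intertwine-if-not-contained D₂ D₁ cv₂ cv₁ (¬∀⟶∃¬ _ _ (λ i → cycle-vertex? D₁ (vert D₂ i)) D₂⊈D₁)
            (vert D₁ i₀ , p₀ , (i₀ , refl)) (λ V → ¬int (inj₂ (inj₁ (vertex-swap {asSub D₂} {asSub D₁} V))))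
            (λ E → ¬int (inj₂ (inj₂ (edge-swap {asSub D₂} {asSub D₁} E)))))
  ...   | yes D₁⊆D₂ | yes D₂⊆D₁ = ⊥-elim (¬same (same-vertices⇒same D₁ D₂ cv₁ cv₂ D₁⊆D₂ D₂⊆D₁))

claim2p4 : ∀ {n : ℕ} (Adj : Fin n → Fin n → Set) →
    SimpleGraph Adj → PartialCube Adj →
    (D₁ D₂ : Cycle Adj) →
    Convex Adj (asSub D₁) → Convex Adj (asSub D₂) →
    ¬ SameSub (asSub D₁) (asSub D₂) →
    ¬ (IntEmpty D₁ D₂ ⊎ IntVertex D₁ D₂ ⊎ IntEdge D₁ D₂) →
    Intertwine D₁ D₂
claim2p4 Adj (adj-sym , irr) partial-cube =
  Intertwining.theorem Adj adj-sym irr (Hypercube.partialCube-metric Adj partial-cube)
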